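{- Let $G$ be a finite simple graph with $n$ vertices and $e$ edges, where $0<e<n(n-1)/2$, and let $\overline{G}$ be its complement. Then \[\mathrm{pm}(\overline{G})=\left(\frac{n(n-1)/2-e}{e}\right)\mathrm{pm}(G).\]
   Context: For a positive integer $m$, $mK_n$ denotes the $m$-fold complete multigraph on $n$ vertices, with exactly $m$ parallel edges between each pair of distinct vertices. For a graph $G$ on $n$ vertices, $mK_n$ "can be partitioned into copies of $G$" if there is a finite list of graphs $G_1,\dots,G_l$, each on the same $n$-element vertex set and each isomorphic to $G$, such that every pair of distinct vertices is an edge of exactly $m$ of the $G_i$. Define $M(G)=\{m\in\mathbb{Z}_{>0} : mK_n \text{ can be partitioned into copies of } G\}$. For a graph with at least one edge, $M(G)$ is non-empty and additively closed, and the partition modulus $\mathrm{pm}(G)$ is defined as the greatest common divisor of $M(G)$ (equivalently, the unique $m_0$ such that $M(G)=m_0\mathbb{N}\setminus F$ for a finite set $F$ of multiples of $m_0$). -}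

module Defs where

open import Data.Nat using (ℕ; zero; suc; _+_; _*_; _∸_; _<_; _/_)
open import Data.Nat.Divisibility using (_∣_)
open import Data.Bool using (Bool; true; false; not; if_then_else_)
open import Data.Fin using (Fin)
import Data.Fin as Fin
open import Data.Fin.Permutation using (Permutation′; _⟨$⟩ʳ_)
open import Data.List using (List; []; _∷_; map; allFin; concatMap)
open import Data.Nat.ListAction using (sum)
open import Data.Product using (Σ; ∃; _×_; _,_)
open import Relation.Nullary using (¬_; does; yes; no)
open import Data.Empty using (⊥-elim)
open import Relation.Binary.PropositionalEquality using (_≡_; refl; cong)
import Relation.Binary.PropositionalEquality as ≡

record SimpleGraph (n : ℕ) : Set where
  field
    adj   : Fin n → Fin n → Bool
    sym   : ∀ i j → adj i j ≡ adj j i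
    loopless : ∀ i → adj i i ≡ false
open SimpleGraph public

boolToℕ : Bool → ℕ
boolToℕ true  = 1
boolToℕ false = 0

edgeCount : ∀ {n} → SimpleGraph n → ℕ
edgeCount {n} G =
  sum (concatMap (λ i → map (λ j → if does (i Fin.<? j) then boolToℕ (adj G i j) else 0)
                            (allFin n))
                 (allFin n))

complementAdj : ∀ {n} → SimpleGraph n → Fin n → Fin n → Bool
complementAdj G i j = if does (i Fin.≟ j) then false else not (adj G i j)

complement-sym : ∀ {n} (G : SimpleGraph n) i j → complementAdj G i j ≡ complementAdj G j i
complement-sym G i j with i Fin.≟ j | j Fin.≟ i
... | yes _ | yes _ = refl
... | yes p | no q = ⊥-elim (q (≡.sym p))
... | no p | yes q = ⊥-elim (p (≡.sym q))
... | no _ | no _ = cong not (sym G i j)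

complement-loopless : ∀ {n} (G : SimpleGraph n) i → complementAdj G i i ≡ false
complement-loopless G i with i Fin.≟ i
... | yes _ = refl
... | no p = ⊥-elim (p refl)

complement : ∀ {n} → SimpleGraph n → SimpleGraph n
complement G = record { adj = complementAdj G ; sym = complement-sym G ; loopless = complement-loopless G }

-- The copy of G obtained by relabelling vertices along a permutation σ
-- (every graph on Fin n isomorphic to G is of this form).
copyAdj : ∀ {n} → SimpleGraph n → Permutation′ n → Fin n → Fin n → Bool
copyAdj G σ i j = adj G (σ ⟨$⟩ʳ i) (σ ⟨$⟩ʳ j)

-- m K_n can be partitioned into copies of G: a finite list of copies such that
-- every pair of distinct vertices is an edge of exactly m of them.
Partitions : ∀ {n} → SimpleGraph n → ℕ → Set
Partitions {n} G m = Σ (List (Permutation′ n)) λ σs →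
  ∀ (i j : Fin n) → ¬ i ≡ j → sum (map (λ σ → boolToℕ (copyAdj G σ i j)) σs) ≡ m

InM : ∀ {n} → SimpleGraph n → ℕ → Set
InM G m = (0 < m) × Partitions G m

-- d = pm(G) = gcd of M(G) (greatest common divisor w.r.t. divisibility)
IsPartitionModulus : ∀ {n} → SimpleGraph n → ℕ → Set
IsPartitionModulus G d =
  (∀ m → InM G m → d ∣ m) × (∀ c → (∀ m → InM G m → c ∣ m) → c ∣ d)

-- Counting ordered pairs of vertices, l copies of G that cover every pair of
-- K_n exactly m times satisfy l·e = m·N, where N = n(n−1)/2.  The complements
-- of the same l copies cover every pair exactly l − m times, and
-- (l − m)·e = m·(N − e).  So m ↦ m(N − e)/e maps M(G) into M(Ḡ), and
-- symmetrically back; passing to greatest common divisors, and using that the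
-- gcd of {k·m : m ∈ M} is k times the gcd of M, gives pm(Ḡ)·e = (N − e)·pm(G).
module Submission where

open import Defs hiding (sym)
open import Data.Nat using (ℕ; zero; suc; _+_; _*_; _∸_; _<_; _/_; z<s; NonZero; ≢-nonZero; ≢-nonZero⁻¹; >-nonZero)
open import Data.Nat.Properties using (+-*-semiring; *-commutativeSemigroup; +-identityʳ; +-suc; *-identityʳ; *-zeroʳ; *-comm; *-distribˡ-+; *-distribʳ-∸; *-cancelˡ-≡; *-mono-<; m+n∸m≡n; m<n⇒0<n∸m)
open import Data.Nat.Divisibility using (_∣_; ∣-antisym; *-monoˡ-∣; *-cancelʳ-∣; ∣n⇒∣m*n)
open import Data.Nat.DivMod using (m*n/n≡m; m/n*n≡m)
open import Data.Nat.GCD using (gcd; gcd[m,n]∣m; gcd[m,n]∣n; gcd[m,n]≡0⇒n≡0)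
open import Data.Nat.Coprimality using (coprime-/gcd; coprime-divisor)
open import Data.Nat.ListAction using (sum)
open import Data.Nat.ListAction.Properties using (sum-++)
open import Data.Bool using (Bool; true; false; not; if_then_else_)
open import Data.Bool.Properties using (not-involutive)
open import Data.Fin using (Fin; zero; suc)
import Data.Fin as Fin
import Data.Fin.Properties as Finₚ
open import Data.Fin.Permutation using (Permutation′; _⟨$⟩ʳ_)
open import Data.List using (List; []; _∷_; map; allFin; concatMap; tabulate; length)
open import Data.List.Properties using (map-tabulate; map-cong)
open import Data.Product using (∃-syntax; _×_; _,_)
open import Relation.Binary.Definitions using (tri<; tri≈; tri>)
open import Relation.Nullary using (¬_; does; yes; no; contradiction)
open import Relation.Nullary.Decidable using (dec-true; dec-false)
open import Function using (_∘_; id)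
open import Function.Bundles using (Injection)
open import Function.Properties.Inverse using (↔⇒↣)
open import Relation.Binary.PropositionalEquality using (_≡_; refl; sym; trans; cong; cong₂; subst; subst₂; module ≡-Reasoning)
open import Algebra.Properties.Semiring.Sum +-*-semiring using (sum-syntax; sum-cong-≗; sum-replicate-zero; ∑-distrib-+; ∑-comm; ∑-permute; *-distribˡ-sum) renaming (sum to ∑)
open import Algebra.Properties.CommutativeSemigroup *-commutativeSemigroup using (x∙yz≈y∙xz; xy∙z≈xz∙y)

private
  variable
    n m : ℕ
    A : Set

∑-const : ∀ n c → ∑[ i < n ] c ≡ n * c
∑-const zero    c = refl
∑-const (suc n) c = cong (c +_) (∑-const n c)

∑∑ : (Fin n → Fin n → ℕ) → ℕ
∑∑ {n} f = ∑[ i < n ] ∑[ j < n ] f i j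

∑∑-cong : {f g : Fin n → Fin n → ℕ} → (∀ i j → f i j ≡ g i j) → ∑∑ f ≡ ∑∑ g
∑∑-cong f≗g = sum-cong-≗ (λ i → sum-cong-≗ (f≗g i))

∑∑-distrib-+ : (f g : Fin n → Fin n → ℕ) → ∑∑ (λ i j → f i j + g i j) ≡ ∑∑ f + ∑∑ g
∑∑-distrib-+ f g = trans (sum-cong-≗ (λ i → ∑-distrib-+ (f i) (g i))) (∑-distrib-+ (λ i → ∑ (f i)) (λ i → ∑ (g i)))

*-distribˡ-∑∑ : ∀ k (f : Fin n → Fin n → ℕ) → k * ∑∑ f ≡ ∑∑ (λ i j → k * f i j)
*-distribˡ-∑∑ k f = trans (*-distribˡ-sum k (λ i → ∑ (f i))) (sum-cong-≗ (λ i → *-distribˡ-sum k (f i)))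

sum-tabulate : ∀ {k} (h : Fin k → ℕ) → sum (tabulate h) ≡ ∑[ i < k ] h i
sum-tabulate {zero}  h = refl
sum-tabulate {suc k} h = cong (h zero +_) (sum-tabulate (h ∘ suc))

sum-map-allFin : (h : Fin n → ℕ) → sum (map h (allFin n)) ≡ ∑[ i < n ] h i
sum-map-allFin {n} h = trans (cong sum (map-tabulate id h)) (sum-tabulate h)

sum-concatMap : (f : A → List ℕ) (xs : List A) → sum (concatMap f xs) ≡ sum (map (sum ∘ f) xs)
sum-concatMap f []       = refl
sum-concatMap f (x ∷ xs) = trans (sum-++ (f x) _) (cong (sum (f x) +_) (sum-concatMap f xs))

sum-map-const : ∀ c (xs : List A) → sum (map (λ _ → c) xs) ≡ length xs * c
sum-map-const c []       = refl
sum-map-const c (_ ∷ xs) = cong (c +_) (sum-map-const c xs)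

sum-map-∑ : (F : A → Fin n → ℕ) (xs : List A) →
  sum (map (λ x → ∑[ i < n ] F x i) xs) ≡ ∑[ i < n ] sum (map (λ x → F x i) xs)
sum-map-∑ {n = n} F []       = sym (sum-replicate-zero n)
sum-map-∑         F (x ∷ xs) = trans (cong (∑ (F x) +_) (sum-map-∑ F xs)) (sym (∑-distrib-+ (F x) _))

sum-map-∑∑ : (F : A → Fin n → Fin n → ℕ) (xs : List A) →
  sum (map (λ x → ∑∑ (F x)) xs) ≡ ∑∑ (λ i j → sum (map (λ x → F x i j) xs))
sum-map-∑∑ F xs = trans (sum-map-∑ (λ x i → ∑ (F x i)) xs) (sum-cong-≗ (λ i → sum-map-∑ (λ x → F x i) xs))

boolToℕ+boolToℕ-not : ∀ b → boolToℕ b + boolToℕ (not b) ≡ 1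
boolToℕ+boolToℕ-not true  = refl
boolToℕ+boolToℕ-not false = refl

sum-map-boolToℕ-not : (p : A → Bool) (xs : List A) →
  sum (map (boolToℕ ∘ p) xs) + sum (map (boolToℕ ∘ not ∘ p) xs) ≡ length xs
sum-map-boolToℕ-not p [] = refl
sum-map-boolToℕ-not p (x ∷ xs) with p x
... | true  = cong suc (sum-map-boolToℕ-not p xs)
... | false = trans (+-suc _ _) (cong suc (sum-map-boolToℕ-not p xs))

arcCount : (Fin n → Fin n → Bool) → ℕ
arcCount r = ∑∑ (λ i j → boolToℕ (r i j))

upperArc : SimpleGraph n → Fin n → Fin n → ℕ
upperArc G i j = if does (i Fin.<? j) then boolToℕ (adj G i j) else 0

edgeCount≡∑∑upperArc : (G : SimpleGraph n) → edgeCount G ≡ ∑∑ (upperArc G)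
edgeCount≡∑∑upperArc {n} G = begin
  edgeCount G                                       ≡⟨ sum-concatMap row (allFin n) ⟩
  sum (map (sum ∘ row) (allFin n))                  ≡⟨ sum-map-allFin (sum ∘ row) ⟩
  ∑[ i < n ] sum (row i)                            ≡⟨ sum-cong-≗ (λ i → sum-map-allFin (upperArc G i)) ⟩
  ∑∑ (upperArc G)                                   ∎
  where
  open ≡-Reasoning
  row : Fin n → List ℕ
  row i = map (upperArc G i) (allFin n)

upperArc-< : (G : SimpleGraph n) {i j : Fin n} → i Fin.< j → upperArc G i j ≡ boolToℕ (adj G i j)
upperArc-< G {i} {j} i<j = cong (if_then boolToℕ (adj G i j) else 0) (dec-true (i Fin.<? j) i<j)

upperArc-≮ : (G : SimpleGraph n) {i j : Fin n} → ¬ i Fin.< j → upperArc G i j ≡ 0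
upperArc-≮ G {i} {j} i≮j = cong (if_then boolToℕ (adj G i j) else 0) (dec-false (i Fin.<? j) i≮j)

arc≡upperArc+upperArc : (G : SimpleGraph n) → ∀ i j → boolToℕ (adj G i j) ≡ upperArc G i j + upperArc G j i
arc≡upperArc+upperArc G i j with Finₚ.<-cmp i j
... | tri< i<j _ j≮i = sym (trans (cong₂ _+_ (upperArc-< G i<j) (upperArc-≮ G j≮i)) (+-identityʳ _))
... | tri≈ i≮i refl _ = trans (cong boolToℕ (loopless G i)) (sym (cong₂ _+_ (upperArc-≮ G i≮i) (upperArc-≮ G i≮i)))
... | tri> i≮j _ j<i = trans (cong boolToℕ (SimpleGraph.sym G i j)) (sym (cong₂ _+_ (upperArc-≮ G i≮j) (upperArc-< G j<i)))

arcCount≡2*edgeCount : (G : SimpleGraph n) → arcCount (adj G) ≡ 2 * edgeCount G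
arcCount≡2*edgeCount G = begin
  arcCount (adj G)                                   ≡⟨ ∑∑-cong (arc≡upperArc+upperArc G) ⟩
  ∑∑ (λ i j → upperArc G i j + upperArc G j i)       ≡⟨ ∑∑-distrib-+ (upperArc G) (λ i j → upperArc G j i) ⟩
  ∑∑ (upperArc G) + ∑∑ (λ i j → upperArc G j i)      ≡⟨ cong (∑∑ (upperArc G) +_) (∑-comm (upperArc G)) ⟨
  ∑∑ (upperArc G) + ∑∑ (upperArc G)                  ≡⟨ cong₂ _+_ e≡ (trans (+-identityʳ _) e≡) ⟨
  2 * edgeCount G                                    ∎
  where
  open ≡-Reasoning
  e≡ : edgeCount G ≡ ∑∑ (upperArc G)
  e≡ = edgeCount≡∑∑upperArc G

offDiagonal : Fin n → Fin n → ℕ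
offDiagonal i j = boolToℕ (not (does (i Fin.≟ j)))

∑-offDiagonal : (i : Fin n) → ∑[ j < n ] offDiagonal i j ≡ n ∸ 1
∑-offDiagonal {suc n}       zero    = trans (∑-const n 1) (*-identityʳ n)
∑-offDiagonal {suc (suc n)} (suc i) = cong suc (∑-offDiagonal i)

∑∑-offDiagonal : ∑∑ {n} offDiagonal ≡ n * (n ∸ 1)
∑∑-offDiagonal {n} = trans (sum-cong-≗ (∑-offDiagonal {n})) (∑-const n (n ∸ 1))

-- A relation between two graphs rather than between G and complement G, so that it is
-- symmetric: complement (complement G) is only pointwise equal to G.
record Complementary (H K : SimpleGraph n) : Set where
  constructor complementary
  field
    adj≡not-adj : ∀ i j → ¬ i ≡ j → adj K i j ≡ not (adj H i j)
open Complementary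

complementary-sym : {H K : SimpleGraph n} → Complementary H K → Complementary K H
complementary-sym H∁K = complementary λ i j i≢j →
  trans (sym (not-involutive _)) (cong not (sym (adj≡not-adj H∁K i j i≢j)))

complement-complementary : (G : SimpleGraph n) → Complementary G (complement G)
complement-complementary G = complementary complement-adj
  where
  complement-adj : ∀ i j → ¬ i ≡ j → complementAdj G i j ≡ not (adj G i j)
  complement-adj i j i≢j with i Fin.≟ j
  ... | yes i≡j = contradiction i≡j i≢j
  ... | no _    = refl

complementary-arc : {H K : SimpleGraph n} → Complementary H K →
  ∀ i j → boolToℕ (adj H i j) + boolToℕ (adj K i j) ≡ offDiagonal i j
complementary-arc {H = H} {K} H∁K i j with i Fin.≟ j
... | yes refl = cong₂ _+_ (cong boolToℕ (loopless H i)) (cong boolToℕ (loopless K i))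
... | no i≢j   = trans (cong (λ b → boolToℕ (adj H i j) + boolToℕ b) (adj≡not-adj H∁K i j i≢j)) (boolToℕ+boolToℕ-not (adj H i j))

complementary-arcCount : {H K : SimpleGraph n} → Complementary H K →
  arcCount (adj H) + arcCount (adj K) ≡ n * (n ∸ 1)
complementary-arcCount {n} {H} {K} H∁K = begin
  arcCount (adj H) + arcCount (adj K)                  ≡⟨ ∑∑-distrib-+ (λ i j → boolToℕ (adj H i j)) (λ i j → boolToℕ (adj K i j)) ⟨
  ∑∑ (λ i j → boolToℕ (adj H i j) + boolToℕ (adj K i j)) ≡⟨ ∑∑-cong (complementary-arc H∁K) ⟩
  ∑∑ {n} offDiagonal                                   ≡⟨ ∑∑-offDiagonal {n} ⟩
  n * (n ∸ 1)                                          ∎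
  where open ≡-Reasoning

complementary-2*edgeCount : {H K : SimpleGraph n} → Complementary H K →
  n * (n ∸ 1) ≡ 2 * (edgeCount H + edgeCount K)
complementary-2*edgeCount {n} {H} {K} H∁K = begin
  n * (n ∸ 1)                                          ≡⟨ complementary-arcCount H∁K ⟨
  arcCount (adj H) + arcCount (adj K)                  ≡⟨ cong₂ _+_ (arcCount≡2*edgeCount H) (arcCount≡2*edgeCount K) ⟩
  2 * edgeCount H + 2 * edgeCount K                    ≡⟨ *-distribˡ-+ 2 (edgeCount H) (edgeCount K) ⟨
  2 * (edgeCount H + edgeCount K)                      ∎
  where open ≡-Reasoning

complementary-edgeCount : {H K : SimpleGraph n} → Complementary H K →
  edgeCount H + edgeCount K ≡ n * (n ∸ 1) / 2
complementary-edgeCount {n} {H} {K} H∁K = begin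
  edgeCount H + edgeCount K                            ≡⟨ m*n/n≡m (edgeCount H + edgeCount K) 2 ⟨
  (edgeCount H + edgeCount K) * 2 / 2                  ≡⟨ cong (_/ 2) (*-comm (edgeCount H + edgeCount K) 2) ⟩
  2 * (edgeCount H + edgeCount K) / 2                  ≡⟨ cong (_/ 2) (complementary-2*edgeCount H∁K) ⟨
  n * (n ∸ 1) / 2                                      ∎
  where open ≡-Reasoning

record Covers (H : SimpleGraph n) (σs : List (Permutation′ n)) (m : ℕ) : Set where
  constructor covers
  field
    multiplicity : ∀ i j → ¬ i ≡ j → sum (map (λ σ → boolToℕ (copyAdj H σ i j)) σs) ≡ m
open Covers

permutation-injective : (σ : Permutation′ n) {i j : Fin n} → σ ⟨$⟩ʳ i ≡ σ ⟨$⟩ʳ j → i ≡ j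
permutation-injective σ = Injection.injective (↔⇒↣ σ)

arcCount-copy : (H : SimpleGraph n) (σ : Permutation′ n) → arcCount (copyAdj H σ) ≡ arcCount (adj H)
arcCount-copy {n} H σ = begin
  arcCount (copyAdj H σ)                              ≡⟨ sum-cong-≗ (λ i → ∑-permute (arcsFrom (σ ⟨$⟩ʳ i)) σ) ⟨
  ∑[ i < n ] ∑[ j < n ] arcsFrom (σ ⟨$⟩ʳ i) j         ≡⟨ ∑-permute (λ x → ∑ (arcsFrom x)) σ ⟨
  arcCount (adj H)                                    ∎
  where
  open ≡-Reasoning
  arcsFrom : Fin n → Fin n → ℕ
  arcsFrom x y = boolToℕ (adj H x y)

covers-everywhere : {H : SimpleGraph n} {σs : List (Permutation′ n)} {m : ℕ} → Covers H σs m →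
  ∀ i j → sum (map (λ σ → boolToℕ (copyAdj H σ i j)) σs) ≡ m * offDiagonal i j
covers-everywhere {H = H} {σs} {m} H-covers i j with i Fin.≟ j
... | yes refl = begin
  sum (map (λ σ → boolToℕ (copyAdj H σ i i)) σs) ≡⟨ cong sum (map-cong (λ σ → cong boolToℕ (loopless H (σ ⟨$⟩ʳ i))) σs) ⟩
  sum (map (λ _ → 0) σs)                         ≡⟨ sum-map-const 0 σs ⟩
  length σs * 0                                  ≡⟨ *-zeroʳ (length σs) ⟩
  0                                              ≡⟨ *-zeroʳ m ⟨
  m * 0                                          ∎
  where open ≡-Reasoning
... | no i≢j = trans (multiplicity H-covers i j i≢j) (sym (*-identityʳ m))

covers-arcCount : {H : SimpleGraph n} {σs : List (Permutation′ n)} {m : ℕ} → Covers H σs m →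
  length σs * arcCount (adj H) ≡ m * (n * (n ∸ 1))
covers-arcCount {n} {H} {σs} {m} H-covers = begin
  length σs * arcCount (adj H)                        ≡⟨ sum-map-const (arcCount (adj H)) σs ⟨
  sum (map (λ _ → arcCount (adj H)) σs)               ≡⟨ cong sum (map-cong (arcCount-copy H) σs) ⟨
  sum (map (λ σ → arcCount (copyAdj H σ)) σs)         ≡⟨ sum-map-∑∑ (λ σ i j → boolToℕ (copyAdj H σ i j)) σs ⟩
  ∑∑ {n} (λ i j → sum (map (λ σ → boolToℕ (copyAdj H σ i j)) σs)) ≡⟨ ∑∑-cong (covers-everywhere H-covers) ⟩
  ∑∑ {n} (λ i j → m * offDiagonal i j)                ≡⟨ *-distribˡ-∑∑ m (offDiagonal {n}) ⟨
  m * ∑∑ {n} offDiagonal                              ≡⟨ cong (m *_) (∑∑-offDiagonal {n}) ⟩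
  m * (n * (n ∸ 1))                                   ∎
  where open ≡-Reasoning

complementary-covers : {H K : SimpleGraph n} {σs : List (Permutation′ n)} {m : ℕ} →
  Complementary H K → Covers H σs m → Covers K σs (length σs ∸ m)
complementary-covers {H = H} {K} {σs} {m} H∁K H-covers = covers complement-multiplicity
  where
  complement-multiplicity : ∀ i j → ¬ i ≡ j → sum (map (λ σ → boolToℕ (copyAdj K σ i j)) σs) ≡ length σs ∸ m
  complement-multiplicity i j i≢j = begin
    sum (map (λ σ → boolToℕ (copyAdj K σ i j)) σs)           ≡⟨ cong sum (map-cong copy-not σs) ⟩
    s̄                                                       ≡⟨ m+n∸m≡n m s̄ ⟨
    m + s̄ ∸ m                                               ≡⟨ cong (λ k → k + s̄ ∸ m) (multiplicity H-covers i j i≢j) ⟨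
    sum (map (λ σ → boolToℕ (copyAdj H σ i j)) σs) + s̄ ∸ m  ≡⟨ cong (_∸ m) (sum-map-boolToℕ-not (λ σ → copyAdj H σ i j) σs) ⟩
    length σs ∸ m                                           ∎
    where
    open ≡-Reasoning
    s̄ : ℕ
    s̄ = sum (map (λ σ → boolToℕ (not (copyAdj H σ i j))) σs)
    copy-not : ∀ σ → boolToℕ (copyAdj K σ i j) ≡ boolToℕ (not (copyAdj H σ i j))
    copy-not σ = cong boolToℕ (adj≡not-adj H∁K (σ ⟨$⟩ʳ i) (σ ⟨$⟩ʳ j) (i≢j ∘ permutation-injective σ))

covers-edgeCount : {H K : SimpleGraph n} {σs : List (Permutation′ n)} {m : ℕ} →
  Complementary H K → Covers H σs m → length σs * edgeCount H ≡ m * (edgeCount H + edgeCount K)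
covers-edgeCount {n} {H} {K} {σs} {m} H∁K H-covers = *-cancelˡ-≡ _ _ 2 (begin
  2 * (length σs * edgeCount H)       ≡⟨ x∙yz≈y∙xz 2 (length σs) (edgeCount H) ⟩
  length σs * (2 * edgeCount H)       ≡⟨ cong (length σs *_) (arcCount≡2*edgeCount H) ⟨
  length σs * arcCount (adj H)        ≡⟨ covers-arcCount H-covers ⟩
  m * (n * (n ∸ 1))                   ≡⟨ cong (m *_) (complementary-2*edgeCount H∁K) ⟩
  m * (2 * (edgeCount H + edgeCount K)) ≡⟨ x∙yz≈y∙xz m 2 (edgeCount H + edgeCount K) ⟩
  2 * (m * (edgeCount H + edgeCount K)) ∎)
  where open ≡-Reasoning

[m∸n]*o≡n*p : ∀ m n o p → m * o ≡ n * (o + p) → (m ∸ n) * o ≡ n * p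
[m∸n]*o≡n*p m n o p eq = begin
  (m ∸ n) * o           ≡⟨ *-distribʳ-∸ o m n ⟩
  m * o ∸ n * o         ≡⟨ cong (_∸ n * o) eq ⟩
  n * (o + p) ∸ n * o   ≡⟨ cong (_∸ n * o) (*-distribˡ-+ n o p) ⟩
  n * o + n * p ∸ n * o ≡⟨ m+n∸m≡n (n * o) (n * p) ⟩
  n * p                 ∎
  where open ≡-Reasoning

m*n≡o∧0<o⇒0<m : ∀ m {n o} → m * n ≡ o → 0 < o → 0 < m
m*n≡o∧0<o⇒0<m zero    refl ()
m*n≡o∧0<o⇒0<m (suc m) _    _ = z<s

complementary-multiplicity : {H K : SimpleGraph n} → Complementary H K → 0 < edgeCount K →
  InM H m → ∃[ m̄ ] InM K m̄ × m̄ * edgeCount H ≡ m * edgeCount K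
complementary-multiplicity {m = m} {H} {K} H∁K 0<eK (0<m , σs , H-multiplicity) =
  m̄ , (0<m̄ , σs , multiplicity (complementary-covers H∁K H-covers)) , m̄-eq
  where
  H-covers : Covers H σs m
  H-covers = covers H-multiplicity
  m̄ : ℕ
  m̄ = length σs ∸ m
  m̄-eq : m̄ * edgeCount H ≡ m * edgeCount K
  m̄-eq = [m∸n]*o≡n*p (length σs) m (edgeCount H) (edgeCount K) (covers-edgeCount H∁K H-covers)
  0<m̄ : 0 < m̄
  0<m̄ = m*n≡o∧0<o⇒0<m m̄ m̄-eq (*-mono-< 0<m 0<eK)

*-greatestDivisor : {Q : ℕ → Set} {d : ℕ} (k : ℕ) .{{_ : NonZero k}} →
  (∀ c → (∀ m → Q m → c ∣ m) → c ∣ d) →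
  ∀ c → (∀ m → Q m → c ∣ k * m) → c ∣ k * d
*-greatestDivisor {Q} {d} k greatest c c∣k*Q =
  subst₂ _∣_ c′*g≡c (trans (xy∙z≈xz∙y k′ d g) (cong (_* d) k′*g≡k)) (*-monoˡ-∣ g (∣n⇒∣m*n k′ (greatest c′ c′∣Q)))
  where
  g : ℕ
  g = gcd c k
  instance
    g≢0 : NonZero g
    g≢0 = ≢-nonZero (≢-nonZero⁻¹ k ∘ gcd[m,n]≡0⇒n≡0 c)
  c′ k′ : ℕ
  c′ = c / g
  k′ = k / g
  c′*g≡c : c′ * g ≡ c
  c′*g≡c = m/n*n≡m (gcd[m,n]∣m c k)
  k′*g≡k : k′ * g ≡ k
  k′*g≡k = m/n*n≡m (gcd[m,n]∣n c k)
  -- c / g and k / g are coprime, so c / g divides every m with c ∣ k * m.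
  c′∣Q : ∀ m → Q m → c′ ∣ m
  c′∣Q m qm = coprime-divisor (coprime-/gcd c k) (*-cancelʳ-∣ g (subst₂ _∣_ (sym c′*g≡c) k*m≡k′*m*g (c∣k*Q m qm)))
    where
    k*m≡k′*m*g : k * m ≡ k′ * m * g
    k*m≡k′*m*g = trans (cong (_* m) (sym k′*g≡k)) (xy∙z≈xz∙y k′ g m)

complementary-modulus-∣ : {H K : SimpleGraph n} {d d̄ : ℕ} → Complementary H K → 0 < edgeCount K →
  IsPartitionModulus H d → IsPartitionModulus K d̄ → d̄ * edgeCount H ∣ edgeCount K * d
complementary-modulus-∣ {H = H} {K} {d̄ = d̄} H∁K 0<eK (_ , H-greatest) (K-divides , _) =
  *-greatestDivisor (edgeCount K) {{>-nonZero 0<eK}} H-greatest (d̄ * edgeCount H) d̄*eH∣eK*M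
  where
  d̄*eH∣eK*M : ∀ m → InM H m → d̄ * edgeCount H ∣ edgeCount K * m
  d̄*eH∣eK*M m m∈M with complementary-multiplicity H∁K 0<eK m∈M
  ... | m̄ , m̄∈M̄ , m̄*eH≡m*eK =
    subst (d̄ * edgeCount H ∣_) (trans m̄*eH≡m*eK (*-comm m (edgeCount K))) (*-monoˡ-∣ (edgeCount H) (K-divides m̄ m̄∈M̄))

complementary-modulus : {H K : SimpleGraph n} {d d̄ : ℕ} → Complementary H K → 0 < edgeCount H → 0 < edgeCount K →
  IsPartitionModulus H d → IsPartitionModulus K d̄ → d̄ * edgeCount H ≡ edgeCount K * d
complementary-modulus {H = H} {K} {d} {d̄} H∁K 0<eH 0<eK H-pm K-pm = ∣-antisym
  (complementary-modulus-∣ H∁K 0<eK H-pm K-pm)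
  (subst₂ _∣_ (*-comm d (edgeCount K)) (*-comm (edgeCount H) d̄) (complementary-modulus-∣ (complementary-sym H∁K) 0<eH K-pm H-pm))

corollary1 : ∀ (n : ℕ) (G : SimpleGraph n) (d d̄ : ℕ)
    → 0 < edgeCount G
    → edgeCount G < n * (n ∸ 1) / 2
    → IsPartitionModulus G d
    → IsPartitionModulus (complement G) d̄
    → d̄ * edgeCount G ≡ (n * (n ∸ 1) / 2 ∸ edgeCount G) * d
corollary1 n G d d̄ 0<e e<N G-pm Ḡ-pm = begin
  d̄ * edgeCount G                      ≡⟨ complementary-modulus G∁Ḡ 0<e 0<ē G-pm Ḡ-pm ⟩
  edgeCount (complement G) * d         ≡⟨ cong (_* d) ē≡N∸e ⟩
  (n * (n ∸ 1) / 2 ∸ edgeCount G) * d  ∎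
  where
  open ≡-Reasoning
  G∁Ḡ : Complementary G (complement G)
  G∁Ḡ = complement-complementary G
  ē≡N∸e : edgeCount (complement G) ≡ n * (n ∸ 1) / 2 ∸ edgeCount G
  ē≡N∸e = trans (sym (m+n∸m≡n (edgeCount G) _)) (cong (_∸ edgeCount G) (complementary-edgeCount G∁Ḡ))
  0<ē : 0 < edgeCount (complement G)
  0<ē = subst (0 <_) (sym ē≡N∸e) (m<n⇒0<n∸m e<N)
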